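{- Let $G$ be a graph with no induced $P_7$, $C_4$, $C_6$ or $C_7$ and with no clique cutset. Let $C=v_1-v_2-v_3-v_4-v_5-v_1$ be an induced $5$-cycle of $G$ (indices modulo $5$), and let $K$ be a connected component of $G[S_0]$ that is not a clique. Then: (1) every vertex of $N(K)\cap S(v_{i-2},v_{i+2})$ is adjacent to all vertices of $K$; (2) $N(K)\cap S(v_{i-1},v_i,v_{i+1})$ or $N(K)\cap S(v_{i+1},v_{i+2},v_{i+3})$ is empty; (3) if $p,q\in N(K)$ are non-adjacent, then $p\in S(v_{i-1},v_i,v_{i+1})$ and $q\in S(v_{i-2},v_{i+2})$ for some $i$ (up to swapping $p$ and $q$); (4) $N(K)$ does not contain four vertices $p,p',q,q'$ with $p\in S(v_{i-1},v_i,v_{i+1})$, $q\in S(v_{i-2},v_{i+2})$, $p'\in S(v_i,v_{i+1},v_{i+2})$ and $q'\in S(v_{i-2},v_{i-1})$.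
   Context: For $X\subseteq V(C)$, $S(X)$ is the set of vertices $v\in V(G)\setminus V(C)$ with $N(v)\cap V(C)=X$; $S_0=S(\emptyset)$. For a vertex set $K$, $N(K)$ is the set of vertices outside $K$ with a neighbor in $K$. A clique cutset is a (possibly empty) clique $S$ such that $G-S$ is disconnected. Statements (1)–(4) hold for every index $i$. -}

module Defs where

open import Data.Nat using (ℕ; suc)
open import Data.Fin using (Fin; zero; suc; toℕ)
open import Data.Fin.Properties using ()
open import Data.List using (List; []; _∷_)
open import Data.List.Membership.Propositional using (_∈_)
open import Data.Product using (Σ; _×_; _,_; ∃; ∃-syntax)
open import Data.Sum using (_⊎_)
open import Data.Empty using (⊥)
open import Relation.Nullary using (¬_; Dec)
open import Relation.Binary.PropositionalEquality using (_≡_; _≢_)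
open import Function.Bundles using (_⇔_)

record Graph : Set₁ where
  field
    n      : ℕ
    E      : Fin n → Fin n → Set
    sym    : ∀ {u v} → E u v → E v u
    irrefl : ∀ {u} → ¬ E u u
    dec    : ∀ u v → Dec (E u v)

module _ (G : Graph) where
  open Graph G

  InducedIn : ∀ {m} → (Fin m → Fin m → Set) → Set
  InducedIn {m} H = Σ (Fin m → Fin n) λ f →
    (∀ i j → f i ≡ f j → i ≡ j) × (∀ i j → E (f i) (f j) ⇔ H i j)

  data Reach (P : Fin n → Set) : Fin n → Fin n → Set where
    here : ∀ {u} → P u → Reach P u u
    step : ∀ {u w v} → P u → E u w → Reach P w v → Reach P u v

  IsClique : (Fin n → Set) → Set
  IsClique S = ∀ u v → S u → S v → u ≢ v → E u v

  IsCliqueCutset : (Fin n → Set) → Set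
  IsCliqueCutset S = IsClique S ×
    (∃[ u ] ∃[ v ] (¬ S u × ¬ S v × ¬ Reach (λ x → ¬ S x) u v))

  HasCliqueCutset : Set₁
  HasCliqueCutset = Σ (Fin n → Set) IsCliqueCutset

PathAdj : ∀ {k} → Fin k → Fin k → Set
PathAdj i j = (toℕ j ≡ suc (toℕ i)) ⊎ (toℕ i ≡ suc (toℕ j))

sucMod : ∀ {k} → Fin (suc k) → Fin (suc k)
sucMod {ℕ.zero} zero = zero
sucMod {suc k} zero = suc zero
sucMod {suc k} (suc i) with sucMod {k} i
... | zero = zero
... | suc j = suc (suc j)

CycleAdj : ∀ {k} → Fin (suc k) → Fin (suc k) → Set
CycleAdj i j = (j ≡ sucMod i) ⊎ (i ≡ sucMod j)


nx : Fin 5 → Fin 5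
nx = sucMod

pv : Fin 5 → Fin 5
pv i = nx (nx (nx (nx i)))

Free : Graph → Set
Free G = ¬ InducedIn G (PathAdj {7}) × ¬ InducedIn G (CycleAdj {3})
       × ¬ InducedIn G (CycleAdj {5}) × ¬ InducedIn G (CycleAdj {6})

module Cyc (G : Graph) where
  open Graph G

  IsInducedC5 : (Fin 5 → Fin n) → Set
  IsInducedC5 c = (∀ i j → c i ≡ c j → i ≡ j) × (∀ i j → E (c i) (c j) ⇔ CycleAdj i j)

  module _ (c : Fin 5 → Fin n) where
    S : List (Fin 5) → Fin n → Set
    S X v = (∀ j → v ≢ c j) × (∀ j → E v (c j) ⇔ (j ∈ X))

    S₀ : Fin n → Set
    S₀ = S []

    Comp : Fin n → Fin n → Set
    Comp k = Reach G S₀ k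

    NotClique : (Fin n → Set) → Set
    NotClique K = ∃[ x ] ∃[ y ] (K x × K y × x ≢ y × ¬ E x y)

    Nbh : (Fin n → Set) → Fin n → Set
    Nbh K v = ¬ K v × ∃[ u ] (K u × E u v)

    S2 : Fin 5 → Fin n → Set
    S2 i = S (pv (pv i) ∷ nx (nx i) ∷ [])

    S3 : Fin 5 → Fin n → Set
    S3 i = S (pv i ∷ i ∷ nx i ∷ [])

{-# OPTIONS --safe #-}
-- Every vertex v of N(K) has a neighbour on C, and C₄-freeness leaves four possibilities for N(v) ∩ C: a vertex,
-- an edge, three consecutive vertices, or all of C. In the first two cases v starts an induced P₅ whose other
-- vertices miss K, so v is complete to K (an edge xy of K with x ∼ v ≁ y would give an induced P₇ y - x - v - …);
-- in the third case v starts an induced P₄ and reaches all of K within distance two through K. For non-adjacent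
-- p, q ∈ N(K): two complete ones form a C₄ with two non-adjacent vertices of K; a common neighbour in K together
-- with one on C forms a C₄; and otherwise an induced path p - x - u - q through K closes up with an arc of C to
-- an induced C₆ or C₇. Only the pairs in (3) survive, and (2) and (4) follow by checking the remaining adjacencies
-- against C₄. Each configuration is treated at position 0 of C and moved to position i by rotating C.
module Submission where

open import Defs
open import Data.Nat using (ℕ; zero; suc; _+_)
import Data.Nat as ℕ
open import Data.Fin using (Fin; zero; suc; toℕ)
open import Data.Fin.Properties using (all?; any?; _≟_)
open import Data.List using (List; []; _∷_)
open import Data.List.Membership.Propositional using (_∈_)
open import Data.List.Membership.DecPropositional (_≟_ {5}) using (_∈?_)
open import Data.Vec using (Vec; []; _∷_; lookup; tabulate)
open import Data.Vec.Properties using (lookup∘tabulate)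
open import Data.Product using (_×_; _,_; proj₁; proj₂; ∃-syntax)
open import Data.Sum using (_⊎_; inj₁; inj₂; swap)
open import Data.Unit using (⊤; tt)
open import Data.Empty using (⊥; ⊥-elim)
open import Function using (_∘_)
open import Function.Bundles using (_⇔_; mk⇔; Equivalence)
open import Function.Properties.Equivalence using () renaming (trans to ⇔-trans; sym to ⇔-sym)
open import Relation.Nullary using (¬_; Dec; yes; no)
open import Relation.Nullary.Decidable
  using (True; False; toWitness; toWitnessFalse; from-yes; map′; decidable-stable; ¬?; _×-dec_; _⊎-dec_; _→-dec_)
open import Relation.Binary.Definitions using (Decidable; Symmetric)
open import Relation.Binary.PropositionalEquality using (_≡_; _≢_; refl; sym; subst; ≢-sym)

pattern f0 = zero
pattern f1 = suc zero
pattern f2 = suc (suc zero)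
pattern f3 = suc (suc (suc zero))
pattern f4 = suc (suc (suc (suc zero)))

_⇔?_ : {A B : Set} → Dec A → Dec B → Dec (A ⇔ B)
a? ⇔? b? = map′ (λ (f , g) → mk⇔ f g) (λ e → Equivalence.to e , Equivalence.from e)
                ((a? →-dec b?) ×-dec (b? →-dec a?))

cycle? : ∀ {k} → Decidable (CycleAdj {k})
cycle? i j = (j ≟ sucMod i) ⊎-dec (i ≟ sucMod j)

path? : ∀ {m} → Decidable (PathAdj {m})
path? i j = (toℕ j ℕ.≟ suc (toℕ i)) ⊎-dec (toℕ i ℕ.≟ suc (toℕ j))

-- Rotations of the 5-cycle

iterate : {A : Set} → (A → A) → ℕ → A → A
iterate f zero    x = x
iterate f (suc m) x = f (iterate f m x)

-- i ⊕ j is the position j steps after i on the 5-cycle; l ⊖ i counts the steps from i to l.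
_⊕_ : Fin 5 → Fin 5 → Fin 5
i ⊕ j = iterate nx (toℕ j) i

_⊖_ : Fin 5 → Fin 5 → Fin 5
l ⊖ i = iterate pv (toℕ i) l

⊕-⊖ : ∀ i l → i ⊕ (l ⊖ i) ≡ l
⊕-⊖ = from-yes (all? λ i → all? λ l → i ⊕ (l ⊖ i) ≟ l)

pv-nx : ∀ j → pv (nx j) ≡ j
pv-nx = from-yes (all? λ j → pv (nx j) ≟ j)

⊕-injective : ∀ i a b → i ⊕ a ≡ i ⊕ b → a ≡ b
⊕-injective = from-yes (all? λ i → all? λ a → all? λ b → (i ⊕ a ≟ i ⊕ b) →-dec (a ≟ b))

⊕-cycleAdj : ∀ i a b → CycleAdj (i ⊕ a) (i ⊕ b) ⇔ CycleAdj a b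
⊕-cycleAdj = from-yes (all? λ i → all? λ a → all? λ b → cycle? (i ⊕ a) (i ⊕ b) ⇔? cycle? a b)

around opposite behind : Fin 5 → List (Fin 5)
around   i = pv i ∷ i ∷ nx i ∷ []
opposite i = pv (pv i) ∷ nx (nx i) ∷ []
behind   i = pv (pv i) ∷ pv i ∷ []

Equivariant : (Fin 5 → List (Fin 5)) → Set
Equivariant F = ∀ i m j → j ∈ F m ⇔ i ⊕ j ∈ F (i ⊕ m)

equivariant? : ∀ F → Dec (Equivariant F)
equivariant? F = all? λ i → all? λ m → all? λ j → (j ∈? F m) ⇔? (i ⊕ j ∈? F (i ⊕ m))

around-equivariant : Equivariant around
around-equivariant = from-yes (equivariant? around)

opposite-equivariant : Equivariant opposite
opposite-equivariant = from-yes (equivariant? opposite)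

behind-equivariant : Equivariant behind
behind-equivariant = from-yes (equivariant? behind)

module _ {Q : Fin 5 → Set} where
  private
    everywhere : (∀ j → Q (nx j) → Q j) → Q f0 → ∀ j → Q j
    everywhere back q₀ f0 = q₀
    everywhere back q₀ f1 = back f1 (back f2 (back f3 (back f4 q₀)))
    everywhere back q₀ f2 = back f2 (back f3 (back f4 q₀))
    everywhere back q₀ f3 = back f3 (back f4 q₀)
    everywhere back q₀ f4 = back f4 q₀

    nowhere : (∀ j → Q (nx j) → Q j) → ¬ Q f0 → ∀ j → ¬ Q j
    nowhere back ¬q₀ f0 = ¬q₀
    nowhere back ¬q₀ f1 = ¬q₀ ∘ back f0
    nowhere back ¬q₀ f2 = ¬q₀ ∘ back f0 ∘ back f1
    nowhere back ¬q₀ f3 = ¬q₀ ∘ back f0 ∘ back f1 ∘ back f2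
    nowhere back ¬q₀ f4 = ¬q₀ ∘ back f0 ∘ back f1 ∘ back f2 ∘ back f3

  boundary : (∀ j → Dec (Q j)) → (∀ j → Q j) ⊎ (∀ j → ¬ Q j) ⊎ ∃[ j ] (¬ Q j × Q (nx j))
  boundary Q? with any? (λ j → ¬? (Q? j) ×-dec Q? (nx j))
  ... | yes switch = inj₂ (inj₂ switch)
  ... | no none    = from (Q? f0)
    where
      back : ∀ j → Q (nx j) → Q j
      back j q = decidable-stable (Q? j) (λ ¬q → none (j , ¬q , q))
      from : Dec (Q f0) → (∀ j → Q j) ⊎ (∀ j → ¬ Q j) ⊎ ∃[ j ] (¬ Q j × Q (nx j))
      from (yes q₀) = inj₁ (everywhere back q₀)
      from (no ¬q₀) = inj₂ (inj₁ (nowhere back ¬q₀))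

-- Induced subgraphs from tables of adjacencies

TwinFree : ∀ {m} → (Fin m → Fin m → Set) → Set
TwinFree H = ∀ i j → (∀ k → H k i ⇔ H k j) → i ≡ j

twinFree? : ∀ {m} {H : Fin m → Fin m → Set} → Decidable H → Dec (TwinFree H)
twinFree? H? = all? λ i → all? λ j → (all? λ k → H? k i ⇔? H? k j) →-dec (i ≟ j)

irreflexive? : ∀ {m} {H : Fin m → Fin m → Set} → Decidable H → Dec (∀ i → ¬ H i i)
irreflexive? H? = all? λ i → ¬? (H? i i)

C4-twins : ∀ i j → (∀ k → CycleAdj {3} k i ⇔ CycleAdj k j) → i ≡ j ⊎ j ≡ sucMod (sucMod i)
C4-twins = from-yes (all? λ i → all? λ j →
  (all? λ k → cycle? {3} k i ⇔? cycle? k j) →-dec ((i ≟ j) ⊎-dec (j ≟ sucMod (sucMod i))))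

module _ (G : Graph) where
  open Graph G renaming (sym to E-sym)
  open Cyc G

  V : Set
  V = Fin n

  ≁-sym : ∀ {x y} → ¬ E x y → ¬ E y x
  ≁-sym ¬xy = ¬xy ∘ E-sym

  separated : ∀ {x y : V} {z} → E x z → ¬ E y z → x ≢ y
  separated xz ¬yz refl = ¬yz xz

  -- Realises H? vs is the nested tuple of the facts E x y or ¬ E x y prescribed by H for the pairs of entries
  -- of vs, row by row: each entry against all later ones.
  Fact : {P : Set} → Dec P → V → V → Set
  Fact (yes _) x y = E x y
  Fact (no _)  x y = ¬ E x y

  fact⇔ : {P : Set} (P? : Dec P) {x y : V} → Fact P? x y → E x y ⇔ P
  fact⇔ (yes p) e  = mk⇔ (λ _ → p) (λ _ → e)
  fact⇔ (no ¬p) ¬e = mk⇔ (⊥-elim ∘ ¬e) (⊥-elim ∘ ¬p)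

  Row : ∀ {m} {P : Fin m → Set} → (∀ j → Dec (P j)) → V → Vec V m → Set
  Row P? x []               = ⊤
  Row P? x (y ∷ [])         = Fact (P? zero) x y
  Row P? x (y ∷ ys@(_ ∷ _)) = Fact (P? zero) x y × Row (P? ∘ suc) x ys

  row⇔ : ∀ {m} {P : Fin m → Set} (P? : ∀ j → Dec (P j)) {x ys} → Row P? x ys → ∀ j → E x (lookup ys j) ⇔ P j
  row⇔ P? {ys = _ ∷ []}    r       zero    = fact⇔ (P? zero) r
  row⇔ P? {ys = _ ∷ _ ∷ _} (r , _) zero    = fact⇔ (P? zero) r
  row⇔ P? {ys = _ ∷ ys@(_ ∷ _)} (_ , r) (suc j) = row⇔ (P? ∘ suc) {ys = ys} r j

  Realises : ∀ {m} {H : Fin m → Fin m → Set} → Decidable H → Vec V m → Set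
  Realises H? []                   = ⊤
  Realises H? (x ∷ [])             = ⊤
  Realises H? (x ∷ xs@(_ ∷ []))    = Row (H? zero ∘ suc) x xs
  Realises H? (x ∷ xs@(_ ∷ _ ∷ _)) = Row (H? zero ∘ suc) x xs × Realises (λ i j → H? (suc i) (suc j)) xs

  private
    uncons : ∀ {m} {H : Fin (suc m) → Fin (suc m) → Set} (H? : Decidable H) {x xs} → Realises H? (x ∷ xs) →
             Row (H? zero ∘ suc) x xs × Realises (λ i j → H? (suc i) (suc j)) xs
    uncons H? {xs = []}        r = tt , tt
    uncons H? {xs = _ ∷ []}    r = r , tt
    uncons H? {xs = _ ∷ _ ∷ _} r = r

  realises⇔ : ∀ {m} {H : Fin m → Fin m → Set} (H? : Decidable H) → Symmetric H → (∀ i → ¬ H i i) →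
              ∀ {vs} → Realises H? vs → ∀ i j → E (lookup vs i) (lookup vs j) ⇔ H i j
  realises⇔ H? H-sym H-irr         r zero    zero    = mk⇔ (⊥-elim ∘ irrefl) (⊥-elim ∘ H-irr zero)
  realises⇔ H? H-sym H-irr {x ∷ xs} r zero   (suc j) =
    row⇔ (H? zero ∘ suc) {x} {xs} (proj₁ (uncons H? {x} {xs} r)) j
  realises⇔ H? H-sym H-irr {x ∷ xs} r (suc i) zero   =
    mk⇔ (H-sym ∘ to ∘ E-sym) (E-sym ∘ from ∘ H-sym)
    where open Equivalence (row⇔ (H? zero ∘ suc) {x} {xs} (proj₁ (uncons H? {x} {xs} r)) i)
  realises⇔ H? H-sym H-irr {x ∷ xs} r (suc i) (suc j) =
    realises⇔ (λ i j → H? (suc i) (suc j)) H-sym (H-irr ∘ suc) {xs} (proj₂ (uncons H? {x} {xs} r)) i j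

  twins : ∀ {m} {H : Fin m → Fin m → Set} {a : Fin m → V} → (∀ i j → E (a i) (a j) ⇔ H i j) →
          ∀ {i j} → a i ≡ a j → ∀ k → H k i ⇔ H k j
  twins {a = a} adj {i} {j} eq k =
    mk⇔ (Equivalence.to (adj k j) ∘ subst (E (a k)) eq ∘ Equivalence.from (adj k i))
        (Equivalence.to (adj k i) ∘ subst (E (a k)) (sym eq) ∘ Equivalence.from (adj k j))

  embed : ∀ {m} {H : Fin m → Fin m → Set} → TwinFree H → {a : Fin m → V} →
          (∀ i j → E (a i) (a j) ⇔ H i j) → InducedIn G H
  embed twin-free {a} adj = a , (λ i j eq → twin-free i j (twins adj eq)) , adj

  first : ∀ {P u v} → Reach G P u v → P u
  first (here p)     = p
  first (step p _ _) = p

  last : ∀ {P u v} → Reach G P u v → P v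
  last (here p)     = p
  last (step _ _ r) = last r

  snoc : ∀ {P u v w} → Reach G P u v → E v w → P w → Reach G P u w
  snoc (here p)     e pw = step p e (here pw)
  snoc (step p e r) f pw = step p e (snoc r f pw)

  Connected : (V → Set) → Set₁
  Connected K = ∀ (Q : V → Set) → (∀ {x y} → K x → K y → E x y → Q x → Q y) →
                ∀ {x y} → K x → K y → Q x → Q y

  S? : ∀ c L v → Dec (S c L v)
  S? c L v = all? (λ j → ¬? (v ≟ c j)) ×-dec all? (λ j → dec v (c j) ⇔? (j ∈? L))

  rotate : ∀ c → IsInducedC5 c → ∀ i → IsInducedC5 (c ∘ (i ⊕_))
  rotate c (c-inj , c-adj) i =
    (λ a b eq → ⊕-injective i a b (c-inj _ _ eq)) , (λ a b → ⇔-trans (c-adj (i ⊕ a) (i ⊕ b)) (⊕-cycleAdj i a b))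

  module _ {c : Fin 5 → V} (F : Fin 5 → List (Fin 5)) (F-eq : Equivariant F) (i m : Fin 5) {v : V} where
    into : S c (F (i ⊕ m)) v → S (c ∘ (i ⊕_)) (F m) v
    into (off , adj) = (λ j → off (i ⊕ j)) , (λ j → ⇔-trans (adj (i ⊕ j)) (⇔-sym (F-eq i m j)))

    out : S (c ∘ (i ⊕_)) (F m) v → S c (F (i ⊕ m)) v
    out (off , adj) =
        (λ j → subst (λ j′ → v ≢ c j′) (⊕-⊖ i j) (off (j ⊖ i)))
      , (λ j → subst (λ j′ → E v (c j′) ⇔ j′ ∈ F (i ⊕ m)) (⊕-⊖ i j) (⇔-trans (adj (j ⊖ i)) (F-eq i m (j ⊖ i))))

  module Cycle (c : Fin 5 → V) (c-ind : IsInducedC5 c) where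
    c∼ : ∀ i j → {True (cycle? i j)} → E (c i) (c j)
    c∼ i j {t} = Equivalence.from (proj₂ c-ind i j) (toWitness t)

    c≁ : ∀ i j → {False (cycle? i j)} → ¬ E (c i) (c j)
    c≁ i j {f} e = toWitnessFalse f (Equivalence.to (proj₂ c-ind i j) e)

    c≢ : ∀ i j → {False (i ≟ j)} → c i ≢ c j
    c≢ i j {f} eq = toWitnessFalse f (proj₁ c-ind i j eq)

    c∼nx : ∀ j → E (c j) (c (nx j))
    c∼nx j = Equivalence.from (proj₂ c-ind j (nx j)) (inj₁ refl)

    hit : ∀ {L v} → S c L v → ∀ j → {True (j ∈? L)} → E v (c j)
    hit s j {t} = Equivalence.from (proj₂ s j) (toWitness t)

    miss : ∀ {L v} → S c L v → ∀ j → {False (j ∈? L)} → ¬ E v (c j)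
    miss s j {f} e = toWitnessFalse f (Equivalence.to (proj₂ s j) e)

    S-intro : ∀ {L v} → (∀ j → v ≢ c j) → Row (_∈? L) v (tabulate c) → S c L v
    S-intro {L} {v} off row =
      off , λ j → subst (λ w → E v w ⇔ j ∈ L) (lookup∘tabulate c j) (row⇔ (_∈? L) {ys = tabulate c} row j)

  module _ (free : Free G) where
    private
      P7-free : ¬ InducedIn G (PathAdj {7})
      P7-free = proj₁ free
      C4-free : ¬ InducedIn G (CycleAdj {3})
      C4-free = proj₁ (proj₂ free)
      C6-free : ¬ InducedIn G (CycleAdj {5})
      C6-free = proj₁ (proj₂ (proj₂ free))
      C7-free : ¬ InducedIn G (CycleAdj {6})
      C7-free = proj₂ (proj₂ (proj₂ free))

      forbidden : ∀ {m} {H : Fin m → Fin m → Set} (H? : Decidable H) → Symmetric H → ¬ InducedIn G H →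
                  {True (twinFree? H?)} → {True (irreflexive? H?)} → (vs : Vec V m) → Realises H? vs → ⊥
      forbidden H? H-sym H-free {twin-free} {irr} vs r =
        H-free (embed (toWitness twin-free) (realises⇔ H? H-sym (toWitness irr) {vs} r))

    noP7 : (vs : Vec V 7) → Realises path? vs → ⊥
    noP7 = forbidden path? swap P7-free

    noC6 : (vs : Vec V 6) → Realises cycle? vs → ⊥
    noC6 = forbidden cycle? swap C6-free

    noC7 : (vs : Vec V 7) → Realises cycle? vs → ⊥
    noC7 = forbidden cycle? swap C7-free

    -- C₄ has twins (opposite vertices), so here injectivity needs the two diagonals to be proper.
    noC4 : ∀ {p q w w′} → p ≢ q → ¬ E p q → w ≢ w′ → ¬ E w w′ → E p w → E p w′ → E q w → E q w′ → ⊥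
    noC4 {p} {q} {w} {w′} p≢q ¬pq w≢w′ ¬ww′ pw pw′ qw qw′ = C4-free (lookup vs , injective , adj)
      where
        vs : Vec V 4
        vs = p ∷ w ∷ q ∷ w′ ∷ []
        adj : ∀ i j → E (lookup vs i) (lookup vs j) ⇔ CycleAdj i j
        adj = realises⇔ cycle? swap (from-yes (irreflexive? (cycle? {3}))) {vs}
                        ((pw , ¬pq , pw′) , (E-sym qw , ¬ww′) , qw′)
        diagonal : ∀ i → lookup vs i ≢ lookup vs (sucMod (sucMod i))
        diagonal f0 = p≢q
        diagonal f1 = w≢w′
        diagonal f2 = ≢-sym p≢q
        diagonal f3 = ≢-sym w≢w′
        injective : ∀ i j → lookup vs i ≡ lookup vs j → i ≡ j
        injective i j eq with C4-twins i j (twins adj eq)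
        ... | inj₁ i≡j  = i≡j
        ... | inj₂ refl = ⊥-elim (diagonal i eq)

    -- Vertices attached to a connected set K

    module Attachment (K : V → Set) (K-connected : Connected K) where
      Complete Anticomplete : V → Set
      Complete v     = ∀ u → K u → E v u
      Anticomplete a = ∀ {x} → K x → ¬ E x a

      WithinTwo : V → V → Set
      WithinTwo v y = E v y ⊎ ∃[ x ] (K x × E v x × E x y)

      Dominates : V → Set
      Dominates v = ∀ y → K y → WithinTwo v y

      complete-via-tail : ∀ {u v a₁ a₂ a₃ a₄} → K u → E v u → Realises path? (v ∷ a₁ ∷ a₂ ∷ a₃ ∷ a₄ ∷ []) →
                          Anticomplete a₁ → Anticomplete a₂ → Anticomplete a₃ → Anticomplete a₄ → Complete v
      complete-via-tail {v = v} {a₁} {a₂} {a₃} {a₄} ku vu tail ¬a₁ ¬a₂ ¬a₃ ¬a₄ y ky =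
        K-connected (E v) extend ku ky vu
        where
          extend : ∀ {x y} → K x → K y → E x y → E v x → E v y
          extend {x} {y} kx ky xy vx with dec v y
          ... | yes vy = vy
          ... | no ¬vy = ⊥-elim (noP7 (y ∷ x ∷ v ∷ a₁ ∷ a₂ ∷ a₃ ∷ a₄ ∷ [])
                  ( (E-sym xy , ≁-sym ¬vy , ¬a₁ ky , ¬a₂ ky , ¬a₃ ky , ¬a₄ ky)
                  , (E-sym vx , ¬a₁ kx , ¬a₂ kx , ¬a₃ kx , ¬a₄ kx)
                  , tail))

      dominating-via-tail : ∀ {u v a₁ a₂ a₃} → K u → E v u → Realises path? (v ∷ a₁ ∷ a₂ ∷ a₃ ∷ []) →
                            Anticomplete a₁ → Anticomplete a₂ → Anticomplete a₃ → Dominates v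
      dominating-via-tail {v = v} {a₁} {a₂} {a₃} ku vu tail ¬a₁ ¬a₂ ¬a₃ y ky =
        K-connected (WithinTwo v) extend ku ky (inj₁ vu)
        where
          extend : ∀ {y z} → K y → K z → E y z → WithinTwo v y → WithinTwo v z
          extend {y} {z} ky kz yz near with dec v z
          ... | yes vz = inj₁ vz
          ... | no ¬vz with near
          ...   | inj₁ vy = inj₂ (y , ky , vy , yz)
          ...   | inj₂ (x , kx , vx , xy) with dec x z | dec v y
          ...     | yes xz | _      = inj₂ (x , kx , vx , xz)
          ...     | no _   | yes vy = inj₂ (y , ky , vy , yz)
          ...     | no ¬xz | no ¬vy = ⊥-elim (noP7 (z ∷ y ∷ x ∷ v ∷ a₁ ∷ a₂ ∷ a₃ ∷ [])
                      ( (E-sym yz , ≁-sym ¬xz , ≁-sym ¬vz , ¬a₁ kz , ¬a₂ kz , ¬a₃ kz)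
                      , (E-sym xy , ≁-sym ¬vy , ¬a₁ ky , ¬a₂ ky , ¬a₃ ky)
                      , (E-sym vx , ¬a₁ kx , ¬a₂ kx , ¬a₃ kx)
                      , tail))

      no-complete-pair : (∃[ x ] ∃[ y ] (K x × K y × x ≢ y × ¬ E x y)) →
                         ∀ {p q} → p ≢ q → ¬ E p q → Complete p → Complete q → ⊥
      no-complete-pair (x , y , kx , ky , x≢y , ¬xy) p≢q ¬pq cp cq =
        noC4 p≢q ¬pq x≢y ¬xy (cp x kx) (cp y ky) (cq x kx) (cq y ky)

    module Reachability {P : V → Set} (P? : ∀ v → Dec (P v)) {k : V} (Pk : P k) where
      Ball : ℕ → V → Set
      Ball zero    v = v ≡ k
      Ball (suc m) v = Ball m v ⊎ (P v × ∃[ u ] (Ball m u × E u v))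

      ball? : ∀ m v → Dec (Ball m v)
      ball? zero    v = v ≟ k
      ball? (suc m) v = ball? m v ⊎-dec (P? v ×-dec any? (λ u → ball? m u ×-dec dec u v))

      ball⇒reach : ∀ m {v} → Ball m v → Reach G P k v
      ball⇒reach zero    refl                  = here Pk
      ball⇒reach (suc m) (inj₁ b)              = ball⇒reach m b
      ball⇒reach (suc m) (inj₂ (Pv , _ , b , e)) = snoc (ball⇒reach m b) e Pv

      grow : ∀ d {m v} → Ball m v → Ball (d + m) v
      grow zero    b = b
      grow (suc d) b = inj₁ (grow d b)

      apart : ∀ d {i u w} → Ball i u → P w → ¬ Ball (d + suc i) w → ¬ E u w
      apart d b Pw ¬b e = ¬b (grow d (inj₂ (Pw , _ , b , e)))

      previous : ∀ {m v} → Ball (suc (suc m)) v → ¬ Ball (suc m) v →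
                 P v × ∃[ u ] ((Ball (suc m) u × ¬ Ball m u) × E u v)
      previous (inj₁ b)                 ¬b = ⊥-elim (¬b b)
      previous (inj₂ (Pv , u , b , e)) ¬b = Pv , u , (b , λ b′ → ¬b (inj₂ (Pv , u , b′ , e))) , e

      first-step : ∀ {v} → Ball 1 v → ¬ Ball 0 v → E k v
      first-step (inj₁ b)                  ¬b = ⊥-elim (¬b b)
      first-step (inj₂ (_ , _ , refl , e)) _  = e

      -- A walk from k through the successive layers is an induced path, so P₇-freeness bounds the depth.
      ball₆⊆ball₅ : ∀ {v} → Ball 6 v → Ball 5 v
      ball₆⊆ball₅ {v} b₆ with ball? 5 v
      ... | yes b₅ = b₅
      ... | no ¬b₅ =
        let (P₆ , u₅ , (b₅ , ¬b₄) , e₅₆) = previous b₆ ¬b₅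
            (P₅ , u₄ , (b₄ , ¬b₃) , e₄₅) = previous b₅ ¬b₄
            (P₄ , u₃ , (b₃ , ¬b₂) , e₃₄) = previous b₄ ¬b₃
            (P₃ , u₂ , (b₂ , ¬b₁) , e₂₃) = previous b₃ ¬b₂
            (P₂ , u₁ , (b₁ , ¬b₀) , e₁₂) = previous b₂ ¬b₁
        in ⊥-elim (noP7 (k ∷ u₁ ∷ u₂ ∷ u₃ ∷ u₄ ∷ u₅ ∷ v ∷ [])
             ( ( first-step b₁ ¬b₀ , apart 0 refl P₂ ¬b₁ , apart 1 refl P₃ ¬b₂ , apart 2 refl P₄ ¬b₃
               , apart 3 refl P₅ ¬b₄ , apart 4 refl P₆ ¬b₅ )
             , (e₁₂ , apart 0 b₁ P₃ ¬b₂ , apart 1 b₁ P₄ ¬b₃ , apart 2 b₁ P₅ ¬b₄ , apart 3 b₁ P₆ ¬b₅)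
             , (e₂₃ , apart 0 b₂ P₄ ¬b₃ , apart 1 b₂ P₅ ¬b₄ , apart 2 b₂ P₆ ¬b₅)
             , (e₃₄ , apart 0 b₃ P₅ ¬b₄ , apart 1 b₃ P₆ ¬b₅)
             , (e₄₅ , apart 0 b₄ P₆ ¬b₅)
             , e₅₆ ))

      within₅ : ∀ {u v} → Ball 5 u → Reach G P u v → Ball 5 v
      within₅ b (here _)     = b
      within₅ b (step _ e r) = within₅ (ball₆⊆ball₅ (inj₂ (first r , _ , b , e))) r

      reachable? : ∀ v → Dec (Reach G P k v)
      reachable? v = map′ (ball⇒reach 5) (within₅ (grow 5 refl)) (ball? 5 v)

    -- Configurations at position 0 of C; position i is reached by applying Frame to the rotated cycle c ∘ (i ⊕_).
    module Frame (c : Fin 5 → V) (c-ind : IsInducedC5 c) {K : V → Set} (K-connected : Connected K)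
                 (K-nonclique : NotClique c K) (K≁c : ∀ {x} → K x → ∀ j → ¬ E x (c j))
                 (N∼c : ∀ {v} → Nbh c K v → ∃[ j ] E v (c j)) where
      open Attachment K K-connected public
      open Cycle c c-ind

      N : V → Set
      N = Nbh c K

      N≢c : ∀ {v} → N v → ∀ j → v ≢ c j
      N≢c (_ , _ , ku , uv) j refl = K≁c ku j uv

      K≢c : ∀ {w} → K w → ∀ j → w ≢ c j
      K≢c kw j refl = K≁c kw (nx j) (c∼nx j)

      common-K-and-cycle : ∀ {p q w} → p ≢ q → ¬ E p q → K w → E p w → E q w →
                           ∀ j → E p (c j) → E q (c j) → ⊥
      common-K-and-cycle p≢q ¬pq kw pw qw j pj qj =
        noC4 p≢q ¬pq (K≢c kw j) (K≁c kw j) pw pj qw qj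

      common-cycle-pair : ∀ a b → {False (cycle? a b)} → {False (a ≟ b)} → ∀ {p q} → p ≢ q → ¬ E p q →
                          E p (c a) → E p (c b) → E q (c a) → E q (c b) → ⊥
      common-cycle-pair a b {¬ab} {a≢b} p≢q ¬pq = noC4 p≢q ¬pq (c≢ a b {a≢b}) (c≁ a b {¬ab})

      no-gap : ∀ j {v} → (∀ i → v ≢ c i) → E v (c (pv j)) → ¬ E v (c j) → E v (c (nx j)) → ⊥
      no-gap j off v₋ ¬v v₊ = noC4 (off j) ¬v (r≢ f4 f1) (r≁ f4 f1) v₋ v₊ (r∼ f0 f4) (r∼ f0 f1)
        where open Cycle (c ∘ (j ⊕_)) (rotate c c-ind j) using () renaming (c∼ to r∼; c≁ to r≁; c≢ to r≢)

      arc-complete : ∀ a {v} → N v → E v (c a) →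
                     ¬ E v (c (a ⊕ f1)) → ¬ E v (c (a ⊕ f2)) → ¬ E v (c (a ⊕ f3)) → Complete v
      arc-complete a (_ , u , ku , uv) v₀ ¬v₁ ¬v₂ ¬v₃ =
        complete-via-tail ku (E-sym uv)
          ((v₀ , ¬v₁ , ¬v₂ , ¬v₃) , (r∼ f0 f1 , r≁ f0 f2 , r≁ f0 f3) , (r∼ f1 f2 , r≁ f1 f3) , r∼ f2 f3)
          (off f0) (off f1) (off f2) (off f3)
        where
          open Cycle (c ∘ (a ⊕_)) (rotate c c-ind a) using () renaming (c∼ to r∼; c≁ to r≁)
          off : ∀ i → Anticomplete (c (a ⊕ i))
          off i kx = K≁c kx (a ⊕ i)

      arc-dominating : ∀ a {v} → N v → E v (c a) → ¬ E v (c (a ⊕ f1)) → ¬ E v (c (a ⊕ f2)) → Dominates v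
      arc-dominating a (_ , u , ku , uv) v₀ ¬v₁ ¬v₂ =
        dominating-via-tail ku (E-sym uv) ((v₀ , ¬v₁ , ¬v₂) , (r∼ f0 f1 , r≁ f0 f2) , r∼ f1 f2)
          (off f0) (off f1) (off f2)
        where
          open Cycle (c ∘ (a ⊕_)) (rotate c c-ind a) using () renaming (c∼ to r∼; c≁ to r≁)
          off : ∀ i → Anticomplete (c (a ⊕ i))
          off i kx = K≁c kx (a ⊕ i)

      opposite-complete₀ : ∀ {v} → N v → S2 c f0 v → Complete v
      opposite-complete₀ nv s = arc-complete f3 nv (hit s f3) (miss s f4) (miss s f0) (miss s f1)

      around-dominating₀ : ∀ {v} → N v → S3 c f0 v → Dominates v
      around-dominating₀ nv s = arc-dominating f1 nv (hit s f1) (miss s f2) (miss s f3)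

      classify₀ : ∀ {v} → N v → E v (c f0) → ¬ E v (c f4) → Complete v ⊎ S3 c f1 v
      classify₀ {v} nv v₀ ¬v₄ with dec v (c f1) | dec v (c f2) | dec v (c f3)
      ... | no ¬v₁ | no ¬v₂ | no ¬v₃ = inj₁ (arc-complete f0 nv v₀ ¬v₁ ¬v₂ ¬v₃)
      ... | no ¬v₁ | yes v₂ | _      = ⊥-elim (no-gap f1 (N≢c nv) v₀ ¬v₁ v₂)
      ... | no _   | no _   | yes v₃ = ⊥-elim (no-gap f4 (N≢c nv) v₃ ¬v₄ v₀)
      ... | yes v₁ | no ¬v₂ | no ¬v₃ = inj₁ (arc-complete f1 nv v₁ ¬v₂ ¬v₃ ¬v₄)
      ... | yes v₁ | no ¬v₂ | yes v₃ = ⊥-elim (no-gap f2 (N≢c nv) v₁ ¬v₂ v₃)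
      ... | yes v₁ | yes v₂ | no ¬v₃ = inj₂ (S-intro (N≢c nv) (v₀ , v₁ , v₂ , ¬v₃ , ¬v₄))
      ... | yes _  | yes _  | yes v₃ = ⊥-elim (no-gap f4 (N≢c nv) v₃ ¬v₄ v₀)

      full-vs-around₀ : ∀ {p q} → p ≢ q → ¬ E p q → (∀ j → E p (c j)) → S3 c f0 q → ⊥
      full-vs-around₀ p≢q ¬pq pc sq = common-cycle-pair f4 f1 p≢q ¬pq (pc f4) (pc f1) (hit sq f4) (hit sq f1)

      complete-vs-around₀ : ∀ {p q} → N p → N q → p ≢ q → ¬ E p q → Complete p → S3 c f0 q → S2 c f0 p
      complete-vs-around₀ {p} {q} np (_ , u , ku , uq) p≢q ¬pq cp sq = by-cases (dec p (c f2)) (dec p (c f3))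
        where
          ¬p : ∀ j → {True (j ∈? around f0)} → ¬ E p (c j)
          ¬p j {t} pj = common-K-and-cycle p≢q ¬pq ku (cp u ku) (E-sym uq) j pj (hit sq j {t})
          by-cases : Dec (E p (c f2)) → Dec (E p (c f3)) → S2 c f0 p
          by-cases (yes p₂) (yes p₃) = S-intro (N≢c np) (¬p f0 , ¬p f1 , p₂ , p₃ , ¬p f4)
          by-cases (yes p₂) (no ¬p₃) = ⊥-elim (noC6 (u ∷ p ∷ c f2 ∷ c f3 ∷ c f4 ∷ q ∷ [])
            ( (E-sym (cp u ku) , K≁c ku f2 , K≁c ku f3 , K≁c ku f4 , uq)
            , (p₂ , ¬p₃ , ¬p f4 , ¬pq)
            , (c∼ f2 f3 , c≁ f2 f4 , ≁-sym (miss sq f2))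
            , (c∼ f3 f4 , ≁-sym (miss sq f3))
            , E-sym (hit sq f4) ))
          by-cases (no ¬p₂) (yes p₃) = ⊥-elim (noC6 (u ∷ p ∷ c f3 ∷ c f2 ∷ c f1 ∷ q ∷ [])
            ( (E-sym (cp u ku) , K≁c ku f3 , K≁c ku f2 , K≁c ku f1 , uq)
            , (p₃ , ¬p₂ , ¬p f1 , ¬pq)
            , (c∼ f3 f2 , c≁ f3 f1 , ≁-sym (miss sq f3))
            , (c∼ f2 f1 , ≁-sym (miss sq f2))
            , E-sym (hit sq f1) ))
          by-cases (no ¬p₂) (no ¬p₃) with N∼c np
          ... | f0 , p₀ = ⊥-elim (¬p f0 p₀)
          ... | f1 , p₁ = ⊥-elim (¬p f1 p₁)
          ... | f2 , p₂ = ⊥-elim (¬p₂ p₂)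
          ... | f3 , p₃ = ⊥-elim (¬p₃ p₃)
          ... | f4 , p₄ = ⊥-elim (¬p f4 p₄)

      -- Closing the induced path p - x - u - q with an arc of C gives an induced C₆ or C₇ (for l = 0, p and q
      -- share two non-adjacent neighbours on C).
      around-path-closes₀ : ∀ {p q u x} → p ≢ q → ¬ E p q → K u → K x →
                            E u q → E x u → E x p → ¬ E x q → ¬ E u p → S3 c f0 p → ∀ l → S3 c l q → ⊥
      around-path-closes₀ p≢q ¬pq ku kx uq xu xp ¬xq ¬up sp f0 sq =
        common-cycle-pair f4 f1 p≢q ¬pq (hit sp f4) (hit sp f1) (hit sq f4) (hit sq f1)
      around-path-closes₀ {p} {q} {u} {x} p≢q ¬pq ku kx uq xu xp ¬xq ¬up sp f1 sq =
        noC7 (x ∷ u ∷ q ∷ c f2 ∷ c f3 ∷ c f4 ∷ p ∷ [])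
          ( (xu , ¬xq , K≁c kx f2 , K≁c kx f3 , K≁c kx f4 , xp)
          , (uq , K≁c ku f2 , K≁c ku f3 , K≁c ku f4 , ¬up)
          , (hit sq f2 , miss sq f3 , miss sq f4 , ≁-sym ¬pq)
          , (c∼ f2 f3 , c≁ f2 f4 , ≁-sym (miss sp f2))
          , (c∼ f3 f4 , ≁-sym (miss sp f3))
          , E-sym (hit sp f4) )
      around-path-closes₀ {p} {q} {u} {x} p≢q ¬pq ku kx uq xu xp ¬xq ¬up sp f2 sq =
        noC6 (x ∷ u ∷ q ∷ c f3 ∷ c f4 ∷ p ∷ [])
          ( (xu , ¬xq , K≁c kx f3 , K≁c kx f4 , xp)
          , (uq , K≁c ku f3 , K≁c ku f4 , ¬up)
          , (hit sq f3 , miss sq f4 , ≁-sym ¬pq)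
          , (c∼ f3 f4 , ≁-sym (miss sp f3))
          , E-sym (hit sp f4) )
      around-path-closes₀ {p} {q} {u} {x} p≢q ¬pq ku kx uq xu xp ¬xq ¬up sp f3 sq =
        noC6 (x ∷ u ∷ q ∷ c f2 ∷ c f1 ∷ p ∷ [])
          ( (xu , ¬xq , K≁c kx f2 , K≁c kx f1 , xp)
          , (uq , K≁c ku f2 , K≁c ku f1 , ¬up)
          , (hit sq f2 , miss sq f1 , ≁-sym ¬pq)
          , (c∼ f2 f1 , ≁-sym (miss sp f2))
          , E-sym (hit sp f1) )
      around-path-closes₀ {p} {q} {u} {x} p≢q ¬pq ku kx uq xu xp ¬xq ¬up sp f4 sq =
        noC7 (x ∷ u ∷ q ∷ c f3 ∷ c f2 ∷ c f1 ∷ p ∷ [])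
          ( (xu , ¬xq , K≁c kx f3 , K≁c kx f2 , K≁c kx f1 , xp)
          , (uq , K≁c ku f3 , K≁c ku f2 , K≁c ku f1 , ¬up)
          , (hit sq f3 , miss sq f2 , miss sq f1 , ≁-sym ¬pq)
          , (c∼ f3 f2 , c≁ f3 f1 , ≁-sym (miss sp f3))
          , (c∼ f2 f1 , ≁-sym (miss sp f2))
          , E-sym (hit sp f1) )

      around-no-common₀ : ∀ {p q w} → p ≢ q → ¬ E p q → S3 c f0 p → ∀ l → S3 c l q → K w → E p w → E q w → ⊥
      around-no-common₀ {p} {q} p≢q ¬pq sp l sq kw pw qw =
        let (j , pj , qj) = meet l sq in common-K-and-cycle p≢q ¬pq kw pw qw j pj qj
        where
          meet : ∀ l → S3 c l q → ∃[ j ] (E p (c j) × E q (c j))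
          meet f0 sq = f0 , hit sp f0 , hit sq f0
          meet f1 sq = f0 , hit sp f0 , hit sq f0
          meet f2 sq = f1 , hit sp f1 , hit sq f1
          meet f3 sq = f4 , hit sp f4 , hit sq f4
          meet f4 sq = f0 , hit sp f0 , hit sq f0

      -- p reaches u within distance two through K, and q has no common neighbour with p in K.
      around-vs-around₀ : ∀ {p q} → N p → N q → p ≢ q → ¬ E p q → S3 c f0 p → ∀ l → S3 c l q → ⊥
      around-vs-around₀ {p} {q} np (_ , u , ku , uq) p≢q ¬pq sp l sq with around-dominating₀ np sp u ku
      ... | inj₁ pu = around-no-common₀ p≢q ¬pq sp l sq ku pu (E-sym uq)
      ... | inj₂ (x , kx , px , xu) with dec x q | dec p u
      ...   | yes xq | _      = around-no-common₀ p≢q ¬pq sp l sq kx px (E-sym xq)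
      ...   | no _   | yes pu = around-no-common₀ p≢q ¬pq sp l sq ku pu (E-sym uq)
      ...   | no ¬xq | no ¬pu =
              around-path-closes₀ p≢q ¬pq ku kx uq xu (E-sym px) ¬xq (≁-sym ¬pu) sp l sq

      around-two-apart₀ : ∀ {p q} → N p → N q → S3 c f0 p → S3 c f2 q → ⊥
      around-two-apart₀ {p} {q} np nq sp sq with dec p q
      ... | yes pq = noC4 (N≢c np f3) (miss sp f3) (≢-sym (N≢c nq f4)) (≁-sym (miss sq f4))
                          (hit sp f4) pq (c∼ f3 f4) (E-sym (hit sq f3))
      ... | no ¬pq = around-vs-around₀ np nq (separated (hit sp f4) (miss sq f4)) ¬pq sp f2 sq

      no-consecutive-pairs₀ : ∀ {p p′ q q′} → N p → N p′ → N q → N q′ →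
                              S3 c f0 p → S2 c f0 q → S3 c f1 p′ → S c (behind f0) q′ → ⊥
      no-consecutive-pairs₀ {p} {p′} {q} {q′} np@(_ , u , ku , up) np′@(_ , u′ , ku′ , u′p′) nq nq′
                            sp sq sp′ sq′ =
        by-cases (dec q q′) (dec p q′) (dec p′ q) (dec p p′)
        where
          cq : Complete q
          cq = opposite-complete₀ nq sq
          cq′ : Complete q′
          cq′ = arc-complete f4 nq′ (hit sq′ f4) (miss sq′ f0) (miss sq′ f1) (miss sq′ f2)
          ¬pq : ¬ E p q
          ¬pq pq = noC4 (N≢c nq f4) (miss sq f4) (≢-sym (N≢c np f3)) (≁-sym (miss sp f3))
                        (hit sq f3) (E-sym pq) (c∼ f4 f3) (E-sym (hit sp f4))
          ¬p′q′ : ¬ E p′ q′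
          ¬p′q′ p′q′ = noC4 (N≢c np′ f4) (miss sp′ f4) (≢-sym (N≢c nq′ f0)) (≁-sym (miss sq′ f0))
                            (hit sp′ f0) p′q′ (c∼ f4 f0) (E-sym (hit sq′ f4))
          by-cases : Dec (E q q′) → Dec (E p q′) → Dec (E p′ q) → Dec (E p p′) → ⊥
          by-cases (no ¬qq′) _ _ _ =
            no-complete-pair K-nonclique (separated (hit sq f2) (miss sq′ f2)) ¬qq′ cq cq′
          by-cases (yes _) (no ¬pq′) _ _ =
            common-K-and-cycle (separated (hit sp f0) (miss sq′ f0)) ¬pq′ ku (E-sym up) (cq′ u ku)
                               f4 (hit sp f4) (hit sq′ f4)
          by-cases (yes _) (yes _) (no ¬p′q) _ =
            common-K-and-cycle (separated (hit sp′ f1) (miss sq f1)) ¬p′q ku′ (E-sym u′p′) (cq u′ ku′)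
                               f2 (hit sp′ f2) (hit sq f2)
          by-cases (yes qq′) (yes pq′) (yes p′q) (yes pp′) =
            noC4 (separated (hit sp f4) (miss sq f4)) ¬pq (separated (hit sq′ f3) (miss sp′ f3)) (≁-sym ¬p′q′)
                 pq′ pp′ qq′ (E-sym p′q)
          by-cases (yes _) (yes _) (yes _) (no ¬pp′) =
            around-vs-around₀ np np′ (separated (hit sp f4) (miss sp′ f4)) ¬pp′ sp f1 sp′

    module AllPositions (c : Fin 5 → V) (c-ind : IsInducedC5 c) {K : V → Set} (K-connected : Connected K)
                (K-nonclique : NotClique c K) (K≁c : ∀ {x} → K x → ∀ j → ¬ E x (c j))
                (N∼c : ∀ {v} → Nbh c K v → ∃[ j ] E v (c j)) (K? : ∀ v → Dec (K v)) where
      open Frame c c-ind K-connected K-nonclique K≁c N∼c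

      rotated-N∼c : ∀ i {v} → N v → ∃[ j ] E v (c (i ⊕ j))
      rotated-N∼c i nv = let (j , vj) = N∼c nv in j ⊖ i , subst (λ j′ → E _ (c j′)) (sym (⊕-⊖ i j)) vj

      module At (i : Fin 5) = Frame (c ∘ (i ⊕_)) (rotate c c-ind i) K-connected K-nonclique
                                     (λ kx j → K≁c kx (i ⊕ j)) (rotated-N∼c i)

      data Kind (v : V) : Set where
        narrow : Complete v → Kind v
        triple : ∀ i → S3 c i v → Kind v
        full   : (∀ j → E v (c j)) → Kind v

      kind : ∀ {v} → N v → Kind v
      kind {v} nv with boundary (λ j → dec v (c j))
      ... | inj₁ all = full all
      ... | inj₂ (inj₁ none) = ⊥-elim (let (j , vj) = N∼c nv in none j vj)
      ... | inj₂ (inj₂ (j , ¬vj , vj₊))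
          with At.classify₀ (nx j) nv vj₊ (subst (λ j′ → ¬ E v (c j′)) (sym (pv-nx j)) ¬vj)
      ...   | inj₁ cv = narrow cv
      ...   | inj₂ s  = triple (nx j ⊕ f1) (out around around-equivariant (nx j) f1 s)

      opposite-complete : ∀ i v → N v → S2 c i v → Complete v
      opposite-complete i v nv s = At.opposite-complete₀ i nv (into opposite opposite-equivariant i f0 s)

      complete-vs-around : ∀ l {p q} → N p → N q → p ≢ q → ¬ E p q → Complete p → S3 c l q → S2 c l p
      complete-vs-around l np nq p≢q ¬pq cp sq =
        out opposite opposite-equivariant l f0
            (At.complete-vs-around₀ l np nq p≢q ¬pq cp (into around around-equivariant l f0 sq))

      around-vs-around : ∀ i l {p q} → N p → N q → p ≢ q → ¬ E p q → S3 c i p → S3 c l q → ⊥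
      around-vs-around i l {q = q} np nq p≢q ¬pq sp sq =
        At.around-vs-around₀ i np nq p≢q ¬pq (into around around-equivariant i f0 sp) (l ⊖ i)
          (into around around-equivariant i (l ⊖ i) (subst (λ l′ → S3 c l′ q) (sym (⊕-⊖ i l)) sq))

      full-vs : ∀ {p q} → N p → N q → p ≢ q → ¬ E p q → (∀ j → E p (c j)) → Kind q → ⊥
      full-vs (_ , u , ku , up) nq p≢q ¬pq pc (narrow cq) =
        let (j , qj) = N∼c nq in common-K-and-cycle p≢q ¬pq ku (E-sym up) (cq u ku) j (pc j) qj
      full-vs _ _ p≢q ¬pq pc (triple l sq) =
        At.full-vs-around₀ l p≢q ¬pq (pc ∘ (l ⊕_)) (into around around-equivariant l f0 sq)
      full-vs _ _ p≢q ¬pq pc (full qc) = common-cycle-pair f0 f2 p≢q ¬pq (pc f0) (pc f2) (qc f0) (qc f2)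

      nonadjacent-pair : ∀ p q → N p → N q → p ≢ q → ¬ E p q →
                         ∃[ i ] ((S3 c i p × S2 c i q) ⊎ (S3 c i q × S2 c i p))
      nonadjacent-pair p q np nq p≢q ¬pq = by-kinds (kind np) (kind nq)
        where
          by-kinds : Kind p → Kind q → ∃[ i ] ((S3 c i p × S2 c i q) ⊎ (S3 c i q × S2 c i p))
          by-kinds (full pc)     kq            = ⊥-elim (full-vs np nq p≢q ¬pq pc kq)
          by-kinds kp            (full qc)     = ⊥-elim (full-vs nq np (≢-sym p≢q) (≁-sym ¬pq) qc kp)
          by-kinds (narrow cp)   (narrow cq)   = ⊥-elim (no-complete-pair K-nonclique p≢q ¬pq cp cq)
          by-kinds (narrow cp)   (triple l sq) = l , inj₂ (sq , complete-vs-around l np nq p≢q ¬pq cp sq)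
          by-kinds (triple i sp) (narrow cq)   =
            i , inj₁ (sp , complete-vs-around i nq np (≢-sym p≢q) (≁-sym ¬pq) cq sp)
          by-kinds (triple i sp) (triple l sq) = ⊥-elim (around-vs-around i l np nq p≢q ¬pq sp sq)

      N? : ∀ v → Dec (N v)
      N? v = ¬? (K? v) ×-dec any? (λ u → K? u ×-dec dec u v)

      around-two-apart : ∀ i → (∀ v → N v → ¬ S3 c i v) ⊎ (∀ v → N v → ¬ S3 c (nx (nx i)) v)
      around-two-apart i with any? (λ v → N? v ×-dec S? c (around i) v)
      ... | no none = inj₁ (λ v nv s → none (v , nv , s))
      ... | yes (p , np , sp) = inj₂ λ q nq sq →
            At.around-two-apart₀ i np nq (into around around-equivariant i f0 sp)
                                         (into around around-equivariant i f2 sq)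

      no-consecutive-pairs : ∀ i p p′ q q′ → N p → N p′ → N q → N q′ →
                             S3 c i p → S2 c i q → S3 c (nx i) p′ → S c (behind i) q′ → ⊥
      no-consecutive-pairs i _ _ _ _ np np′ nq nq′ sp sq sp′ sq′ =
        At.no-consecutive-pairs₀ i np np′ nq nq′
          (into around around-equivariant i f0 sp) (into opposite opposite-equivariant i f0 sq)
          (into around around-equivariant i f1 sp′) (into behind behind-equivariant i f0 sq′)

    module Component (c : Fin 5 → V) {k : V} (k₀ : S₀ c k) where
      K : V → Set
      K = Comp c k

      K≁c : ∀ {x} → K x → ∀ j → ¬ E x (c j)
      K≁c kx j xj with Equivalence.to (proj₂ (last kx) j) xj
      ... | ()

      K-connected : Connected K
      K-connected Q Q-closed kx ky qx =
        along Q-closed (here k₀) ky (along backwards (here k₀) kx (λ qk → qk) qx)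
        where
          along : ∀ {Q : V → Set} → (∀ {x y} → K x → K y → E x y → Q x → Q y) →
                  ∀ {u v} → K u → Reach G (S₀ c) u v → Q u → Q v
          along closed ku (here _)     qu = qu
          along closed ku (step {w = w} _ e r) qu = along closed kw r (closed ku kw e qu)
            where
              kw : K w
              kw = snoc ku e (first r)
          backwards : ∀ {x y} → K x → K y → E x y → (Q x → Q k) → (Q y → Q k)
          backwards kx ky xy f qy = f (Q-closed ky kx (E-sym xy) qy)

      N∼c : ∀ {v} → Nbh c K v → ∃[ j ] E v (c j)
      N∼c {v} (¬kv , u , ku , uv) with any? (λ j → dec v (c j))
      ... | yes vj = vj
      ... | no none = ⊥-elim (¬kv (snoc ku uv (off , λ j → mk⇔ (λ vj → ⊥-elim (none (j , vj))) λ ())))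
        where
          off : ∀ j → v ≢ c j
          off j refl = K≁c ku j uv

      K? : ∀ v → Dec (K v)
      K? = Reachability.reachable? (S? c []) k₀

lemma9p1 : (G : Graph) → Free G → ¬ HasCliqueCutset G →
    (c : Fin 5 → Fin (Graph.n G)) → Cyc.IsInducedC5 G c →
    (k : Fin (Graph.n G)) → Cyc.S₀ G c k → Cyc.NotClique G c (Cyc.Comp G c k) →
    let open Graph G
        open Cyc G
        K = Comp c k
        N = Nbh c K
    in (∀ i v → N v → S2 c i v → ∀ u → K u → E v u)
     × (∀ i → (∀ v → N v → ¬ S3 c i v) ⊎ (∀ v → N v → ¬ S3 c (nx (nx i)) v))
     × (∀ p q → N p → N q → p ≢ q → ¬ E p q →
          ∃[ i ] ((S3 c i p × S2 c i q) ⊎ (S3 c i q × S2 c i p)))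
     × (∀ i p p′ q q′ → N p → N p′ → N q → N q′ →
          S3 c i p → S2 c i q → S3 c (nx i) p′ →
          S c (pv (pv i) ∷ pv i ∷ []) q′ → ⊥)
lemma9p1 G free _ c c-ind k k₀ K-nonclique =
    opposite-complete
  , around-two-apart
  , nonadjacent-pair
  , no-consecutive-pairs
  where
    open Component G free c k₀
    open AllPositions G free c c-ind K-connected K-nonclique K≁c N∼c K?
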